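{- Let $p,q$ be distinct propositional letters. Define $p^0:=q\looparrowright p$ and $p^{n+1}:=p\to p^n$, and for $T\subseteq\omega\setminus\{0\}$ let $\Lambda_T:=\{q\looparrowright p^m:m\in T\}$. If $P$ and $T$ are non-empty subsets of $\omega\setminus\{0\}$ with $P\neq T$, then $\mathcal{F}\Lambda_P\neq\mathcal{F}\Lambda_T$.
   Context: Let $\Phi=\{p_0,p_1,\dots\}$ be a countably infinite set of propositional letters; $\mathsf{FOR}$ is the set of formulas built from $\Phi$ with $\neg$ and binary $\lor,\wedge,\to,\leftrightarrow,\vartriangle,\looparrowright$. $\mathcal{F}$ is the least set of formulas containing all classical tautologies (in this language), $(p\looparrowright q)\to(p\to q)$ and $(p\vartriangle q)\leftrightarrow((p\looparrowright q)\wedge(p\wedge q))$, closed under uniform substitution (endomorphisms of the formula algebra) and modus ponens. For $\Lambda\subseteq\mathsf{FOR}$, $\mathcal{F}\Lambda$ is the least set containing $\mathcal{F}\cup\Lambda$ closed under uniform substitution and modus ponens. (Semantically, Epstein models are $\langle v,\mathfrak{R}\rangle$ with $v:\Phi\to\{0,1\}$, $\mathfrak{R}\subseteq\mathsf{FOR}^2$; boolean connectives are classical, $\psi\vartriangle\chi$ is true iff $\psi,\chi$ true and $\langle\psi,\chi\rangle\in\mathfrak{R}$, $\psi\looparrowright\chi$ is true iff ($\psi$ false or $\chi$ true) and $\langle\psi,\chi\rangle\in\mathfrak{R}$; $\mathcal{F}\Lambda$ is the set of formulas true in every model of all substitution instances of $\Lambda$.) -}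

module Defs where

open import Data.Nat using (ℕ; zero; suc)
open import Data.Bool using (Bool; true; false; not; _∧_; _∨_)
open import Data.Product using (Σ; _×_; ∃; _,_)
open import Relation.Binary.PropositionalEquality using (_≡_)
open import Relation.Unary using (Pred)
open import Level using (0ℓ)

infixr 5 _⇒_
data Fm : Set where
  var  : ℕ → Fm
  ¬'   : Fm → Fm
  _∨'_ _∧'_ _⇒_ _⇔'_ _△_ _↬_ : Fm → Fm → Fm

sub : (ℕ → Fm) → Fm → Fm
sub σ (var i)   = σ i
sub σ (¬' a)    = ¬' (sub σ a)
sub σ (a ∨' b)  = sub σ a ∨' sub σ b
sub σ (a ∧' b)  = sub σ a ∧' sub σ b
sub σ (a ⇒ b)   = sub σ a ⇒ sub σ b
sub σ (a ⇔' b)  = sub σ a ⇔' sub σ b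
sub σ (a △ b)   = sub σ a △ sub σ b
sub σ (a ↬ b)   = sub σ a ↬ sub σ b

-- Boolean evaluation: letters and △/↬-formulas are treated as atoms,
-- interpreted by w; boolean connectives are classical.
_⇒ᵇ_ : Bool → Bool → Bool
a ⇒ᵇ b = not a ∨ b

_⇔ᵇ_ : Bool → Bool → Bool
a ⇔ᵇ b = (a ⇒ᵇ b) ∧ (b ⇒ᵇ a)

bev : (Fm → Bool) → Fm → Bool
bev w (var i)   = w (var i)
bev w (¬' a)    = not (bev w a)
bev w (a ∨' b)  = bev w a ∨ bev w b
bev w (a ∧' b)  = bev w a ∧ bev w b
bev w (a ⇒ b)   = bev w a ⇒ᵇ bev w b
bev w (a ⇔' b)  = bev w a ⇔ᵇ bev w b
bev w (a △ b)   = w (a △ b)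
bev w (a ↬ b)   = w (a ↬ b)

Taut : Fm → Set
Taut φ = (w : Fm → Bool) → bev w φ ≡ true

p₀ p₁ : Fm
p₀ = var 0
p₁ = var 1

data FL (Λ : Pred Fm 0ℓ) : Fm → Set where
  taut : ∀ {φ} → Taut φ → FL Λ φ
  ax1  : FL Λ ((p₀ ↬ p₁) ⇒ (p₀ ⇒ p₁))
  ax2  : FL Λ ((p₀ △ p₁) ⇔' ((p₀ ↬ p₁) ∧' (p₀ ∧' p₁)))
  hyp  : ∀ {φ} → Λ φ → FL Λ φ
  usub : ∀ {φ} (σ : ℕ → Fm) → FL Λ φ → FL Λ (sub σ φ)
  mp   : ∀ {φ ψ} → FL Λ φ → FL Λ (φ ⇒ ψ) → FL Λ ψ

pow : Fm → Fm → ℕ → Fm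
pow p q zero    = q ↬ p
pow p q (suc n) = p ⇒ pow p q n

ΛT : Fm → Fm → Pred ℕ 0ℓ → Pred Fm 0ℓ
ΛT p q T φ = Σ ℕ λ m → T m × (φ ≡ (q ↬ pow p q m))

-- Fix m and consider the Epstein model in which every letter is false and
-- ⟨ψ, χ⟩ ∈ ℜ fails exactly when ψ is a letter and χ is an implication chain
-- ψ₁ → ⋯ → ψₘ → ξ of length m.  There q ↬ pᵐ is false.  For k ≠ m, k ≥ 1, every
-- instance B ↬ (A → ⋯ → A → (B ↬ A)) of q ↬ pᵏ is true: if B is true it is no
-- letter, so the relation holds and the chain is true all the way down; if B is
-- false the implication holds, and the chain has length k ≠ m.  Hence q ↬ pᵐ lies
-- in 𝓕Λ_T only if m ∈ T, so 𝓕Λ_P = 𝓕Λ_T forces P = T.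
module Submission where

open import Defs
open import Data.Nat using (ℕ; zero; suc; _≟_)
open import Data.Bool using (Bool; true; false; not; _∧_; _∨_)
open import Data.Bool.Properties using (∧-zeroʳ)
open import Data.Empty using (⊥-elim)
open import Data.Product using (∃; _,_)
open import Data.Sum using (_⊎_; inj₁; inj₂)
open import Function using (_∘_)
open import Function.Bundles using (_⇔_; mk⇔; Equivalence)
open import Level using (0ℓ)
open import Relation.Binary.PropositionalEquality
  using (_≡_; _≢_; refl; sym; trans; cong; cong₂; subst; module ≡-Reasoning)
open import Relation.Nullary using (¬_; does; yes; no)
open import Relation.Nullary.Decidable using (dec-true; dec-false)
open import Relation.Unary using (Pred)

sub-sub : ∀ σ τ φ → sub σ (sub τ φ) ≡ sub (sub σ ∘ τ) φ
sub-sub σ τ (var i)  = refl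
sub-sub σ τ (¬' a)   = cong ¬' (sub-sub σ τ a)
sub-sub σ τ (a ∨' b) = cong₂ _∨'_ (sub-sub σ τ a) (sub-sub σ τ b)
sub-sub σ τ (a ∧' b) = cong₂ _∧'_ (sub-sub σ τ a) (sub-sub σ τ b)
sub-sub σ τ (a ⇒ b)  = cong₂ _⇒_ (sub-sub σ τ a) (sub-sub σ τ b)
sub-sub σ τ (a ⇔' b) = cong₂ _⇔'_ (sub-sub σ τ a) (sub-sub σ τ b)
sub-sub σ τ (a △ b)  = cong₂ _△_ (sub-sub σ τ a) (sub-sub σ τ b)
sub-sub σ τ (a ↬ b)  = cong₂ _↬_ (sub-sub σ τ a) (sub-sub σ τ b)

sub-pow : ∀ σ p q k → sub σ (pow p q k) ≡ pow (sub σ p) (sub σ q) k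
sub-pow σ p q zero    = refl
sub-pow σ p q (suc k) = cong (sub σ p ⇒_) (sub-pow σ p q k)

⇒ᵇ-mp : ∀ {x y} → x ≡ true → x ⇒ᵇ y ≡ true → y ≡ true
⇒ᵇ-mp {true} {true} _ _ = refl

⇒ᵇ-trueʳ : ∀ x {y} → y ≡ true → x ⇒ᵇ y ≡ true
⇒ᵇ-trueʳ true  refl = refl
⇒ᵇ-trueʳ false _    = refl

⇒ᵇ-falseˡ : ∀ {x} y → x ≡ false → x ⇒ᵇ y ≡ true
⇒ᵇ-falseˡ y refl = refl

module EpsteinModel (v : ℕ → Bool) (R : Fm → Fm → Bool) where

  ⟦_⟧ : Fm → Bool
  ⟦ var n ⟧  = v n
  ⟦ ¬' a ⟧   = not ⟦ a ⟧
  ⟦ a ∨' b ⟧ = ⟦ a ⟧ ∨ ⟦ b ⟧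
  ⟦ a ∧' b ⟧ = ⟦ a ⟧ ∧ ⟦ b ⟧
  ⟦ a ⇒ b ⟧  = ⟦ a ⟧ ⇒ᵇ ⟦ b ⟧
  ⟦ a ⇔' b ⟧ = ⟦ a ⟧ ⇔ᵇ ⟦ b ⟧
  ⟦ a △ b ⟧  = (⟦ a ⟧ ∧ ⟦ b ⟧) ∧ R a b
  ⟦ a ↬ b ⟧  = (⟦ a ⟧ ⇒ᵇ ⟦ b ⟧) ∧ R a b

  ⟦sub⟧ : ∀ σ φ → ⟦ sub σ φ ⟧ ≡ bev (⟦_⟧ ∘ sub σ) φ
  ⟦sub⟧ σ (var i)  = refl
  ⟦sub⟧ σ (¬' a)   = cong not (⟦sub⟧ σ a)
  ⟦sub⟧ σ (a ∨' b) = cong₂ _∨_ (⟦sub⟧ σ a) (⟦sub⟧ σ b)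
  ⟦sub⟧ σ (a ∧' b) = cong₂ _∧_ (⟦sub⟧ σ a) (⟦sub⟧ σ b)
  ⟦sub⟧ σ (a ⇒ b)  = cong₂ _⇒ᵇ_ (⟦sub⟧ σ a) (⟦sub⟧ σ b)
  ⟦sub⟧ σ (a ⇔' b) = cong₂ _⇔ᵇ_ (⟦sub⟧ σ a) (⟦sub⟧ σ b)
  ⟦sub⟧ σ (a △ b)  = refl
  ⟦sub⟧ σ (a ↬ b)  = refl

  Valid : Fm → Set
  Valid φ = ∀ σ → ⟦ sub σ φ ⟧ ≡ true

  Taut⇒Valid : ∀ {φ} → Taut φ → Valid φ
  Taut⇒Valid {φ} t σ = trans (⟦sub⟧ σ φ) (t _)

  ax1-valid : Valid ((p₀ ↬ p₁) ⇒ (p₀ ⇒ p₁))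
  ax1-valid σ = check (⟦ σ 0 ⟧ ⇒ᵇ ⟦ σ 1 ⟧) (R (σ 0) (σ 1))
    where
    check : ∀ x r → (x ∧ r) ⇒ᵇ x ≡ true
    check true  true  = refl
    check true  false = refl
    check false _     = refl

  ax2-valid : Valid ((p₀ △ p₁) ⇔' ((p₀ ↬ p₁) ∧' (p₀ ∧' p₁)))
  ax2-valid σ = check ⟦ σ 0 ⟧ ⟦ σ 1 ⟧ (R (σ 0) (σ 1))
    where
    check : ∀ a b r → ((a ∧ b) ∧ r) ⇔ᵇ (((a ⇒ᵇ b) ∧ r) ∧ (a ∧ b)) ≡ true
    check true  true  true  = refl
    check true  true  false = refl
    check true  false true  = refl
    check true  false false = refl
    check false true  true  = refl
    check false true  false = refl
    check false false true  = refl
    check false false false = refl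

  usub-valid : ∀ {φ} τ → Valid φ → Valid (sub τ φ)
  usub-valid {φ} τ vφ σ = subst (λ ψ → ⟦ ψ ⟧ ≡ true) (sym (sub-sub σ τ φ)) (vφ (sub σ ∘ τ))

  mp-valid : ∀ {φ ψ} → Valid φ → Valid (φ ⇒ ψ) → Valid ψ
  mp-valid vφ vφ⇒ψ σ = ⇒ᵇ-mp (vφ σ) (vφ⇒ψ σ)

  -- A excuses the axioms of Λ that may fail in the model; keeping it as a
  -- disjunct avoids deciding A.
  sound-or : {A : Set} {Λ : Pred Fm 0ℓ} → (∀ {φ} → Λ φ → A ⊎ Valid φ) →
             ∀ {φ} → FL Λ φ → A ⊎ Valid φ
  sound-or Λ-ok (taut {φ} t) = inj₂ (Taut⇒Valid {φ} t)
  sound-or Λ-ok ax1          = inj₂ ax1-valid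
  sound-or Λ-ok ax2          = inj₂ ax2-valid
  sound-or Λ-ok (hyp λφ)     = Λ-ok λφ
  sound-or Λ-ok (usub {φ} τ d) with sound-or Λ-ok d
  ... | inj₁ a  = inj₁ a
  ... | inj₂ vφ = inj₂ (usub-valid {φ} τ vφ)
  sound-or Λ-ok (mp {φ} {ψ} d e) with sound-or Λ-ok d | sound-or Λ-ok e
  ... | inj₁ a  | _         = inj₁ a
  ... | inj₂ _  | inj₁ a    = inj₁ a
  ... | inj₂ vφ | inj₂ vφ⇒ψ = inj₂ (mp-valid {φ} {ψ} vφ vφ⇒ψ)

isVar : Fm → Bool
isVar (var _) = true
isVar _       = false

⇒-length : Fm → ℕ
⇒-length (_ ⇒ b) = suc (⇒-length b)
⇒-length _       = zero

⇒-length-pow : ∀ p q k → ⇒-length (pow p q k) ≡ k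
⇒-length-pow p q zero    = refl
⇒-length-pow p q (suc k) = cong suc (⇒-length-pow p q k)

separating : ℕ → Fm → Fm → Bool
separating m ψ χ = not (isVar ψ ∧ does (⇒-length χ ≟ m))

module Separating (m : ℕ) where
  open EpsteinModel (λ _ → false) (separating m) public

  true⇒separating : ∀ {ψ} χ → ⟦ ψ ⟧ ≡ true → separating m ψ χ ≡ true
  true⇒separating {var _}  χ ()
  true⇒separating {¬' _}   χ _ = refl
  true⇒separating {_ ∨' _} χ _ = refl
  true⇒separating {_ ∧' _} χ _ = refl
  true⇒separating {_ ⇒ _}  χ _ = refl
  true⇒separating {_ ⇔' _} χ _ = refl
  true⇒separating {_ △ _}  χ _ = refl
  true⇒separating {_ ↬ _}  χ _ = refl

  pow-true : ∀ a b k → ⟦ a ⟧ ≡ true → ⟦ b ⟧ ≡ true → ⟦ pow a b k ⟧ ≡ true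
  pow-true a b zero    ⟦a⟧ ⟦b⟧ rewrite ⟦a⟧ | ⟦b⟧ = true⇒separating a ⟦b⟧
  pow-true a b (suc k) ⟦a⟧ ⟦b⟧ = ⇒ᵇ-trueʳ ⟦ a ⟧ (pow-true a b k ⟦a⟧ ⟦b⟧)

  pow-suc-true : ∀ a b k → ⟦ b ⟧ ≡ true → ⟦ pow a b (suc k) ⟧ ≡ true
  pow-suc-true a b k ⟦b⟧ with ⟦ a ⟧ in ⟦a⟧
  ... | true  = pow-true a b k ⟦a⟧ ⟦b⟧
  ... | false = refl

  ↬-true : ∀ b c → ⟦ b ⟧ ≡ true → ⟦ c ⟧ ≡ true → ⟦ b ↬ c ⟧ ≡ true
  ↬-true b c ⟦b⟧ ⟦c⟧ = cong₂ _∧_ (⇒ᵇ-trueʳ ⟦ b ⟧ ⟦c⟧) (true⇒separating c ⟦b⟧)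

  ↬-false : ∀ b c → ⟦ b ⟧ ≡ false → ⇒-length c ≢ m → ⟦ b ↬ c ⟧ ≡ true
  ↬-false b c ⟦b⟧ len≢m = cong₂ _∧_ (⇒ᵇ-falseˡ ⟦ c ⟧ ⟦b⟧) (begin
    not (isVar b ∧ does (⇒-length c ≟ m)) ≡⟨ cong (λ x → not (isVar b ∧ x)) (dec-false (⇒-length c ≟ m) len≢m) ⟩
    not (isVar b ∧ false)                 ≡⟨ cong not (∧-zeroʳ (isVar b)) ⟩
    true                                  ∎)
    where open ≡-Reasoning

  -- pow a b 0 = b ↬ a fails when b is true and a false; this is why 0 ∉ T.
  pow-axiom-true : ∀ a b k → k ≢ 0 → k ≢ m → ⟦ b ↬ pow a b k ⟧ ≡ true
  pow-axiom-true a b zero    k≢0 _   with () ← k≢0 refl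
  pow-axiom-true a b (suc k) _   k≢m = by-value ⟦ b ⟧ refl
    where
    by-value : ∀ x → ⟦ b ⟧ ≡ x → ⟦ b ↬ pow a b (suc k) ⟧ ≡ true
    by-value true  ⟦b⟧ = ↬-true b (pow a b (suc k)) ⟦b⟧ (pow-suc-true a b k ⟦b⟧)
    by-value false ⟦b⟧ = ↬-false b (pow a b (suc k)) ⟦b⟧ (k≢m ∘ trans (sym (⇒-length-pow a b (suc k))))

  ΛT-valid-or : ∀ i j (T : Pred ℕ 0ℓ) → (∀ k → T k → k ≢ 0) →
                ∀ {φ} → ΛT (var i) (var j) T φ → T m ⊎ Valid φ
  ΛT-valid-or i j T T≢0 (k , Tk , refl) with k ≟ m
  ... | yes refl = inj₁ Tk
  ... | no k≢m   = inj₂ λ σ →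
    subst (λ χ → ⟦ σ j ↬ χ ⟧ ≡ true) (sym (sub-pow σ (var i) (var j) k))
          (pow-axiom-true (σ i) (σ j) k (T≢0 k Tk) k≢m)

  pow-axiom-invalid : ∀ i j → ¬ Valid (var j ↬ pow (var i) (var j) m)
  pow-axiom-invalid i j valid with valid var
  ... | ⟦φ⟧ rewrite sub-pow var (var i) (var j) m | ⇒-length-pow (var i) (var j) m
                  | dec-true (m ≟ m) refl with () ← ⟦φ⟧

pow-axiom∈FLΛT⇒∈ : ∀ i j m (T : Pred ℕ 0ℓ) → (∀ k → T k → k ≢ 0) →
  FL (ΛT (var i) (var j) T) (var j ↬ pow (var i) (var j) m) → T m
pow-axiom∈FLΛT⇒∈ i j m T T≢0 d
  with Separating.sound-or m (Separating.ΛT-valid-or m i j T T≢0) d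
... | inj₁ Tm    = Tm
... | inj₂ valid = ⊥-elim (Separating.pow-axiom-invalid m i j valid)

mainTheorem19 : (i j : ℕ) → i ≢ j →
    (P T : Pred ℕ 0ℓ) →
    (∀ m → P m → m ≢ 0) → (∀ m → T m → m ≢ 0) →
    ∃ P → ∃ T →
    ¬ (∀ m → P m ⇔ T m) →
    ¬ (∀ φ → FL (ΛT (var i) (var j) P) φ ⇔ FL (ΛT (var i) (var j) T) φ)
mainTheorem19 i j _ P T P≢0 T≢0 _ _ P≠T same = P≠T λ m →
  let axiom = var j ↬ pow (var i) (var j) m in
  mk⇔ (λ Pm → pow-axiom∈FLΛT⇒∈ i j m T T≢0 (Equivalence.to (same axiom) (hyp (m , Pm , refl))))
      (λ Tm → pow-axiom∈FLΛT⇒∈ i j m P P≢0 (Equivalence.from (same axiom) (hyp (m , Tm , refl))))
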